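{- Let $\pi\in S_n$. Then $\mathrm{SHS}(\pi^{rp})=\mathrm{SHS}(\pi)^r$ and $\mathrm{SHS}(\pi^{evac})=\mathrm{SHS}(\pi)^{evac}$.
   Context: For $\pi=x_1x_2\cdots x_n\in S_n$ in one-line notation, $\pi^{rp}=x_nx_{n-1}\cdots x_1$ and $\pi^{evac}=(n+1-x_n)(n+1-x_{n-1})\cdots(n+1-x_1)$. For $\pi\in S_n$, $\mathrm{SHS}(\pi)$ denotes its sequence of intervals: an interval of $\pi$ is an increasing subsequence consisting of consecutive integers $a,a+1,\dots,b$ appearing in this left-to-right order in $\pi$, and $\mathrm{SHS}(\pi)=(\pi^1,\dots,\pi^k)$ is the complete list of maximal intervals of $\pi$, ordered so that concatenating them gives $1,\dots,n$. For a sequence $s=(s_1,\dots,s_k)$ of blocks of consecutive integers whose concatenation is $1,\dots,n$: the reverse $s^r$ is the unique such sequence in which, for each $1\le i<n$, $i$ and $i+1$ lie in the same block of $s^r$ if and only if they lie in different blocks of $s$. The evacuation $s^{evac}$ is obtained by replacing every integer $i$ by $n+1-i$, reordering the integers in each block increasingly, and reordering the blocks so that their concatenation is $1,\dots,n$. -}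

module Defs where

open import Data.Nat using (ℕ; suc; _<_)
open import Data.Fin using (Fin; toℕ; opposite)
open import Data.Fin.Properties using (opposite-involutive)
open import Data.Fin.Permutation using (Permutation′; permutation; _∘ₚ_; _⟨$⟩ʳ_; _⟨$⟩ˡ_)
open import Data.List using (List; []; _∷_; concat; map; reverse; allFin)
open import Data.List.Relation.Unary.All using (All)
open import Data.List.Relation.Unary.Any using (Any)
open import Data.List.Relation.Unary.AllPairs using (AllPairs)
open import Data.List.Relation.Unary.Linked using (Linked)
open import Data.List.Membership.Propositional using (_∈_)
open import Data.Product using (_×_; ∃)
open import Relation.Binary.PropositionalEquality using (_≡_)
open import Relation.Nullary using (¬_)
open import Function.Bundles using (_⇔_)

-- Convention: permutations of Fin n; the values 1..n of the paper are
-- the values 0..n-1 here, and n+1-x becomes opposite x (= n-1-x).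
-- One-line notation: x_i = π ⟨$⟩ʳ i; the position of value v is π ⟨$⟩ˡ v.

oppP : ∀ {n} → Permutation′ n
oppP = permutation opposite opposite opposite-involutive opposite-involutive

-- π^rp : i ↦ π(n-1-i)   (reverse the one-line word)
rp : ∀ {n} → Permutation′ n → Permutation′ n
rp π = oppP ∘ₚ π

-- π^evac : i ↦ n-1-π(n-1-i)
evacP : ∀ {n} → Permutation′ n → Permutation′ n
evacP π = oppP ∘ₚ π ∘ₚ oppP

pos : ∀ {n} → Permutation′ n → Fin n → Fin n
pos π v = π ⟨$⟩ˡ v

NonEmpty : ∀ {A : Set} → List A → Set
NonEmpty xs = ∃ λ y → y ∈ xs

Consecutive : ∀ {n} → List (Fin n) → Set
Consecutive = Linked (λ x y → toℕ y ≡ suc (toℕ x))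

IsInterval : ∀ {n} → Permutation′ n → List (Fin n) → Set
IsInterval π b =
  NonEmpty b × Consecutive b × AllPairs (λ x y → toℕ (pos π x) < toℕ (pos π y)) b

IsMaximalInterval : ∀ {n} → Permutation′ n → List (Fin n) → Set
IsMaximalInterval π b =
  IsInterval π b ×
  (∀ c → IsInterval π c → (∀ x → x ∈ b → x ∈ c) → ∀ x → x ∈ c → x ∈ b)

IsSHS : ∀ {n} → Permutation′ n → List (List (Fin n)) → Set
IsSHS {n} π s =
  All (IsMaximalInterval π) s ×
  (∀ b → IsMaximalInterval π b → b ∈ s) ×
  concat s ≡ allFin n

SameBlock : ∀ {n} → List (List (Fin n)) → Fin n → Fin n → Set
SameBlock s i j = Any (λ b → i ∈ b × j ∈ b) s

-- t is the reverse s^r of s: a sequence of (nonempty) blocks of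
-- consecutive integers concatenating to 1..n, in which i and i+1 share a
-- block iff they do not share a block of s.
IsRev : ∀ {n} → List (List (Fin n)) → List (List (Fin n)) → Set
IsRev {n} s t =
  concat t ≡ allFin n × All NonEmpty t ×
  (∀ (i j : Fin n) → toℕ j ≡ suc (toℕ i) → SameBlock t i j ⇔ (¬ SameBlock s i j))

-- s^evac: replace i by n+1-i, reorder each block increasingly (the image
-- of a block of consecutive integers is decreasing, so reorder = reverse),
-- and reorder the blocks so the concatenation is 1..n (= reverse the list).
evacS : ∀ {n} → List (List (Fin n)) → List (List (Fin n))
evacS s = reverse (map (λ b → reverse (map opposite b)) s)

-- The maximal intervals of π are its maximal runs i, i + 1, …, j in which each k + 1
-- stands to the right of k.  Hence SHS(π) is the unique sequence of nonempty blocks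
-- concatenating to 1, …, n in which i and i + 1 share a block exactly when i + 1 stands
-- to the right of i in π: maximality of the intervals gives one direction, and
-- uniqueness holds because the blocks are ordered by their (disjoint) contents.
-- Reading π backwards negates this relation at every i, which is how s^r is defined.
-- In π^evac, i + 1 stands right of i iff n + 1 - i stands right of n - i in π, which
-- is exactly when n - i and n + 1 - i share a block of s, i.e. when i and i + 1 share
-- a block of s^evac.
module Submission where

open import Defs
open import Data.Nat using (ℕ; zero; suc; _<_; _∸_; s≤s)
open import Data.Nat.Properties using (≤-refl; <-trans; <-irrefl; <-asym; ≮⇒≥; ≤∧≢⇒<; ∸-monoʳ-<; +-∸-assoc)
open import Data.Fin using (Fin; toℕ; opposite; inject₁) renaming (zero to fzero; suc to fsuc; _<_ to _<ᶠ_)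
open import Data.Fin.Properties using (toℕ-injective; toℕ-inject₁; toℕ<n; opposite-prop; opposite-involutive; _≟_)
open import Data.Fin.Permutation using (Permutation′; _⟨$⟩ʳ_; inverseʳ)
open import Data.List using (List; []; _∷_; _++_; _∷ʳ_; [_]; concat; map; reverse; tabulate; allFin)
open import Data.List.Properties using (unfold-reverse; reverse-++; concat-++; concat-map; map-∘; ++-identityʳ)
open import Data.List.Relation.Unary.All as All using (All; []; _∷_)
import Data.List.Relation.Unary.All.Properties as Allₚ
open import Data.List.Relation.Unary.Any as Any using (Any; here; there)
import Data.List.Relation.Unary.Any.Properties as Anyₚ
open import Data.List.Relation.Unary.AllPairs as AllPairs using (AllPairs; []; _∷_)
import Data.List.Relation.Unary.AllPairs.Properties as AllPairsₚ
open import Data.List.Relation.Unary.Linked as Linked using (Linked; []; [-]; _∷_)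
open import Data.List.Relation.Unary.Linked.Properties using (Linked⇒AllPairs; AllPairs⇒Linked)
open import Data.List.Relation.Binary.Subset.Propositional using (_⊆_)
open import Data.List.Membership.Propositional using (_∈_; _∉_; find; lose)
open import Data.List.Membership.Propositional.Properties
  using (∈-++⁺ˡ; ∈-++⁺ʳ; ∈-++⁻; ∈-allFin; ∈-concat⁺′; ∈-concat⁻′; ∈-map⁺; ∈-map⁻)
import Data.List.Membership.DecPropositional as DecMembership
open import Data.Product using (_×_; _,_; proj₁; proj₂; ∃; swap)
open import Data.Sum using (_⊎_; inj₁; inj₂)
open import Data.Empty using (⊥-elim)
open import Function using (_∘_; flip)
open import Function.Bundles using (_⇔_; mk⇔; Equivalence)
open import Function.Construct.Composition using (_⇔-∘_)
open import Function.Construct.Symmetry using (⇔-sym)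
open import Relation.Binary.Definitions using (Asymmetric)
open import Relation.Binary.PropositionalEquality
  using (_≡_; _≢_; refl; sym; trans; cong; cong₂; subst; subst₂; module ≡-Reasoning)
open import Relation.Nullary using (¬_; yes; no)

open Equivalence using (to; from)

private variable
  A : Set
  R S : A → A → Set
  P : A → Set
  x y z : A
  xs ys : List A
  xss : List (List A)

¬-⇔ : {B C : Set} → B ⇔ C → (¬ B) ⇔ (¬ C)
¬-⇔ B⇔C = mk⇔ (λ ¬b → ¬b ∘ from B⇔C) (λ ¬c → ¬c ∘ to B⇔C)

Across : (A → A → Set) → List A → List A → Set
Across R xs ys = ∀ {x y} → x ∈ xs → y ∈ ys → R x y

Linked-++⁻ : ∀ xs → Linked R (xs ++ ys) → Linked R xs × Linked R ys
Linked-++⁻ []           l       = [] , l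
Linked-++⁻ (x ∷ [])     [-]     = [-] , []
Linked-++⁻ (x ∷ [])     (_ ∷ l) = [-] , l
Linked-++⁻ (x ∷ y ∷ xs) (r ∷ l) = let l₁ , l₂ = Linked-++⁻ (y ∷ xs) l in r ∷ l₁ , l₂

Linked-concat⁻ : ∀ xss → Linked R (concat xss) → All (Linked R) xss
Linked-concat⁻ []         _ = []
Linked-concat⁻ (xs ∷ xss) l = let l₁ , l₂ = Linked-++⁻ xs l in l₁ ∷ Linked-concat⁻ xss l₂

Linked-tabulate⁺ : ∀ {n} {f : Fin (suc n) → A} → (∀ i → R (f (inject₁ i)) (f (fsuc i))) → Linked R (tabulate f)
Linked-tabulate⁺ {n = zero}  _ = [-]
Linked-tabulate⁺ {n = suc n} {f} r = r fzero ∷ Linked-tabulate⁺ {f = f ∘ fsuc} (r ∘ fsuc)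

Linked-∷ʳ⁺ : ∀ xs → Linked R (xs ∷ʳ x) → R x y → Linked R (xs ∷ʳ x ∷ʳ y)
Linked-∷ʳ⁺ []           _          r = r ∷ [-]
Linked-∷ʳ⁺ (_ ∷ [])     (r′ ∷ [-]) r = r′ ∷ r ∷ [-]
Linked-∷ʳ⁺ (_ ∷ x ∷ xs) (r′ ∷ l)   r = r′ ∷ Linked-∷ʳ⁺ (x ∷ xs) l r

Linked-mapWith∈ : (∀ {x y} → x ∈ xs → y ∈ xs → R x y → S x y) → Linked R xs → Linked S xs
Linked-mapWith∈ _ []      = []
Linked-mapWith∈ _ [-]     = [-]
Linked-mapWith∈ f (r ∷ l) = f (here refl) (there (here refl)) r ∷ Linked-mapWith∈ (λ x∈ y∈ → f (there x∈) (there y∈)) l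

Linked-ends-at : (∀ {x y z} → R x y → R x z → y ≡ z) →
  Linked R xs → x ∈ xs → R x y → y ∉ xs → ∃ λ ys → xs ≡ ys ∷ʳ x
Linked-ends-at _ [] ()
Linked-ends-at _ [-] (here refl) _ _ = [] , refl
Linked-ends-at _ [-] (there ())
Linked-ends-at functional (r′ ∷ _) (here refl) r y∉ = ⊥-elim (y∉ (there (here (functional r r′))))
Linked-ends-at {xs = w ∷ _} functional (_ ∷ l) (there x∈) r y∉ =
  let ys , eq = Linked-ends-at functional l x∈ r (y∉ ∘ there) in w ∷ ys , cong (w ∷_) eq

Linked-propagate : (∀ {x y} → R x y → P x ⇔ P y) → Linked R xs → x ∈ xs → P x → All P xs
Linked-propagate _ [] ()
Linked-propagate _ [-] (here refl) px = px ∷ []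
Linked-propagate _ [-] (there ())
Linked-propagate closed (r ∷ l) (here refl) px = px ∷ Linked-propagate closed l (here refl) (to (closed r) px)
Linked-propagate closed (r ∷ l) (there x∈) px with py ∷ pys ← Linked-propagate closed l x∈ px =
  from (closed r) py ∷ py ∷ pys

AllPairs-++⁻ : ∀ xs → AllPairs R (xs ++ ys) → Across R xs ys × AllPairs R ys
AllPairs-++⁻ []       p          = (λ ()) , p
AllPairs-++⁻ (x ∷ xs) (rx ∷ rxs) = across , proj₂ (AllPairs-++⁻ xs rxs)
  where
  across : Across _ (x ∷ xs) _
  across (here refl) y∈ = All.lookup rx (∈-++⁺ʳ xs y∈)
  across (there x∈)  y∈ = proj₁ (AllPairs-++⁻ xs rxs) x∈ y∈

AllPairs-concat⁻ : ∀ xss → AllPairs R (concat xss) → AllPairs (Across R) xss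
AllPairs-concat⁻ []         _ = []
AllPairs-concat⁻ (xs ∷ xss) p =
  All.tabulate (λ ys∈ x∈ y∈ → proj₁ split x∈ (∈-concat⁺′ y∈ ys∈)) ∷ AllPairs-concat⁻ xss (proj₂ split)
  where split = AllPairs-++⁻ xs p

All-reverse⁺ : All P xs → All P (reverse xs)
All-reverse⁺ pxs = All.tabulate (All.lookup pxs ∘ Anyₚ.reverse⁻)

AllPairs-reverse⁺ : AllPairs R xs → AllPairs (flip R) (reverse xs)
AllPairs-reverse⁺ {xs = []}     []         = []
AllPairs-reverse⁺ {xs = x ∷ xs} (rx ∷ rxs) = subst (AllPairs _) (sym (unfold-reverse x xs))
  (AllPairsₚ.++⁺ (AllPairs-reverse⁺ rxs) ([] ∷ [])
    (All-reverse⁺ (All.map (_∷ []) rx)))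

AllPairs-withAll : All P xs → AllPairs R xs → AllPairs (λ x y → P x × R x y) xs
AllPairs-withAll []         []         = []
AllPairs-withAll (px ∷ pxs) (rx ∷ rxs) = All.map (px ,_) rx ∷ AllPairs-withAll pxs rxs

AllPairs-transfer : Asymmetric R → AllPairs R xs → AllPairs S xs → x ∈ xs → y ∈ xs → R x y → S x y
AllPairs-transfer asym _ _ (here refl) (here refl) r = ⊥-elim (asym r r)
AllPairs-transfer _ _ (sx ∷ _) (here refl) (there y∈) _ = All.lookup sx y∈
AllPairs-transfer asym (rx ∷ _) _ (there x∈) (here refl) r = ⊥-elim (asym r (All.lookup rx x∈))
AllPairs-transfer asym (_ ∷ rxs) (_ ∷ sxs) (there x∈) (there y∈) r = AllPairs-transfer asym rxs sxs x∈ y∈ r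

∷-heads-≡ : Asymmetric R → All (R x) xs → All (R y) ys → x ∈ y ∷ ys → y ∈ x ∷ xs → x ≡ y
∷-heads-≡ _ _ _ (here x≡y) _ = x≡y
∷-heads-≡ _ _ _ (there _) (here y≡x) = sym y≡x
∷-heads-≡ asym rx ry (there x∈) (there y∈) = ⊥-elim (asym (All.lookup rx y∈) (All.lookup ry x∈))

∷-⊆-tail : Asymmetric R → All (R x) xs → x ∷ xs ⊆ x ∷ ys → xs ⊆ ys
∷-⊆-tail asym rx ⊆ z∈ with ⊆ (there z∈)
... | here refl = ⊥-elim (asym (All.lookup rx z∈) (All.lookup rx z∈))
... | there z∈′ = z∈′

AllPairs-unique : Asymmetric R → AllPairs R xs → AllPairs R ys → xs ⊆ ys → ys ⊆ xs → xs ≡ ys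
AllPairs-unique _ [] [] _ _ = refl
AllPairs-unique _ [] (_ ∷ _) _ ys⊆xs with () ← ys⊆xs (here refl)
AllPairs-unique _ (_ ∷ _) [] xs⊆ys _ with () ← xs⊆ys (here refl)
AllPairs-unique asym (rx ∷ rxs) (ry ∷ rys) xs⊆ys ys⊆xs
  with refl ← ∷-heads-≡ asym rx ry (xs⊆ys (here refl)) (ys⊆xs (here refl)) =
  cong (_ ∷_) (AllPairs-unique asym rxs rys (∷-⊆-tail asym rx xs⊆ys) (∷-⊆-tail asym ry ys⊆xs))

∈-sameBlock : (∀ {x} → ¬ R x x) → AllPairs (Across R) xss → xs ∈ xss → x ∈ xs →
  Any (λ ys → x ∈ ys × y ∈ ys) xss → y ∈ xs
∈-sameBlock _ _ (here refl) _ (here (_ , y∈)) = y∈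
∈-sameBlock irrefl (across ∷ _) (here refl) x∈ (there shared)
  with _ , ys∈ , x∈ys , _ ← find shared = ⊥-elim (irrefl (All.lookup across ys∈ x∈ x∈ys))
∈-sameBlock irrefl (across ∷ _) (there xs∈) x∈ (here (x∈ys , _)) =
  ⊥-elim (irrefl (All.lookup across xs∈ x∈ys x∈))
∈-sameBlock irrefl (_ ∷ separated) (there xs∈) x∈ (there shared) = ∈-sameBlock irrefl separated xs∈ x∈ shared

∈-reverse-map⇔ : {f : A → A} → (∀ x → f (f x) ≡ x) → x ∈ reverse (map f xs) ⇔ f x ∈ xs
∈-reverse-map⇔ {x = x} {xs = xs} {f = f} involutive = mk⇔ ⇒ ⇐
  where
  ⇒ : x ∈ reverse (map f xs) → f x ∈ xs
  ⇒ x∈ with y , y∈ , refl ← ∈-map⁻ f (Anyₚ.reverse⁻ x∈) = subst (_∈ xs) (sym (involutive y)) y∈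
  ⇐ : f x ∈ xs → x ∈ reverse (map f xs)
  ⇐ fx∈ = Anyₚ.reverse⁺ (subst (_∈ map f xs) (involutive x) (∈-map⁺ f fx∈))

concat-reverse-map-reverse : ∀ (xss : List (List A)) → concat (reverse (map reverse xss)) ≡ reverse (concat xss)
concat-reverse-map-reverse [] = refl
concat-reverse-map-reverse (xs ∷ xss) = begin
  concat (reverse (reverse xs ∷ map reverse xss))          ≡⟨ cong concat (unfold-reverse (reverse xs) (map reverse xss)) ⟩
  concat (reverse (map reverse xss) ∷ʳ reverse xs)         ≡⟨ concat-++ (reverse (map reverse xss)) [ reverse xs ] ⟨
  concat (reverse (map reverse xss)) ++ (reverse xs ++ []) ≡⟨ cong₂ _++_ (concat-reverse-map-reverse xss) (++-identityʳ (reverse xs)) ⟩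
  reverse (concat xss) ++ reverse xs                       ≡⟨ reverse-++ xs (concat xss) ⟨
  reverse (xs ++ concat xss)                               ∎
  where open ≡-Reasoning

opposite-< : ∀ {n} {i j : Fin n} → toℕ j < toℕ i → toℕ (opposite i) < toℕ (opposite j)
opposite-< {i = i} {j} j<i rewrite opposite-prop i | opposite-prop j = ∸-monoʳ-< (s≤s j<i) (toℕ<n i)

opposite-<⇔ : ∀ {n} {i j : Fin n} → toℕ (opposite i) < toℕ (opposite j) ⇔ toℕ j < toℕ i
opposite-<⇔ {i = i} {j} = mk⇔
  (subst₂ (λ a b → toℕ a < toℕ b) (opposite-involutive j) (opposite-involutive i) ∘ opposite-<)
  opposite-<

allFin-consecutive : ∀ n → Consecutive (allFin n)
allFin-consecutive zero    = []
allFin-consecutive (suc n) = Linked-tabulate⁺ {f = λ i → i} (λ i → cong suc (sym (toℕ-inject₁ i)))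

module _ {n : ℕ} where
  open DecMembership (_≟_ {n}) using (_∈?_)

  Succ : Fin n → Fin n → Set
  Succ i j = toℕ j ≡ suc (toℕ i)

  Precedes : Permutation′ n → Fin n → Fin n → Set
  Precedes σ i j = toℕ (pos σ i) < toℕ (pos σ j)

  -- IsRev s t is, by definition, JoinedBy (λ i j → ¬ SameBlock s i j) t.
  JoinedBy : (Fin n → Fin n → Set) → List (List (Fin n)) → Set
  JoinedBy Join t = concat t ≡ allFin n × All NonEmpty t × (∀ i j → Succ i j → SameBlock t i j ⇔ Join i j)

  JoinedBy-cong : ∀ {R S t} → (∀ {i j} → Succ i j → R i j ⇔ S i j) → JoinedBy R t ⇔ JoinedBy S t
  JoinedBy-cong {t = t} R⇔S = mk⇔ (transport R⇔S) (transport (⇔-sym ∘ R⇔S))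
    where
    transport : ∀ {R S} → (∀ {i j} → Succ i j → R i j ⇔ S i j) → JoinedBy R t → JoinedBy S t
    transport R⇔S (concat≡ , nonEmpty , joins) = concat≡ , nonEmpty , λ i j i⋖j → R⇔S i⋖j ⇔-∘ joins i j i⋖j

  Succ-functional : ∀ {i j k} → Succ i j → Succ i k → j ≡ k
  Succ-functional j≡1+i k≡1+i = toℕ-injective (trans j≡1+i (sym k≡1+i))

  Succ⇒< : ∀ {i j} → Succ i j → i <ᶠ j
  Succ⇒< {i} j≡1+i = subst (toℕ i <_) (sym j≡1+i) ≤-refl

  Consecutive⇒sorted : ∀ {xs} → Consecutive xs → AllPairs _<ᶠ_ xs
  Consecutive⇒sorted = Linked⇒AllPairs <-trans ∘ Linked.map Succ⇒<

  allFin-sorted : AllPairs _<ᶠ_ (allFin n)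
  allFin-sorted = AllPairsₚ.tabulate⁺-< (λ i<j → i<j)

  Succ-opposite : ∀ {i j} → Succ i j → Succ (opposite j) (opposite i)
  Succ-opposite {i} {j} j≡1+i = begin
    toℕ (opposite i)            ≡⟨ opposite-prop i ⟩
    n ∸ suc (toℕ i)             ≡⟨ +-∸-assoc 1 (subst (_< n) j≡1+i (toℕ<n j)) ⟩
    suc (n ∸ suc (suc (toℕ i))) ≡⟨ cong (λ k → suc (n ∸ suc k)) j≡1+i ⟨
    suc (n ∸ suc (toℕ j))       ≡⟨ cong suc (opposite-prop j) ⟨
    suc (toℕ (opposite j))      ∎
    where open ≡-Reasoning

  pos-injective : ∀ (σ : Permutation′ n) {i j} → pos σ i ≡ pos σ j → i ≡ j
  pos-injective σ {i} {j} eq = begin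
    i                 ≡⟨ inverseʳ σ ⟨
    σ ⟨$⟩ʳ pos σ i    ≡⟨ cong (σ ⟨$⟩ʳ_) eq ⟩
    σ ⟨$⟩ʳ pos σ j    ≡⟨ inverseʳ σ ⟩
    j                 ∎
    where open ≡-Reasoning

  Precedes-rp : ∀ (π : Permutation′ n) {i j} → i ≢ j → Precedes (rp π) i j ⇔ (¬ Precedes π i j)
  Precedes-rp π i≢j = mk⇔
    (λ j<i i<j → <-asym i<j (to opposite-<⇔ j<i))
    (λ i≮j → opposite-< (≤∧≢⇒< (≮⇒≥ i≮j) (i≢j ∘ pos-injective π ∘ toℕ-injective ∘ sym)))

  Precedes-evacP : ∀ (π : Permutation′ n) {i j} → Precedes (evacP π) i j ⇔ Precedes π (opposite j) (opposite i)
  Precedes-evacP π = opposite-<⇔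

  blocks-separated : ∀ {t} → concat t ≡ allFin n → AllPairs (Across _<ᶠ_) t
  blocks-separated {t} concat≡ = AllPairs-concat⁻ t (subst (AllPairs _<ᶠ_) (sym concat≡) allFin-sorted)

  blocks-consecutive : ∀ {t} → concat t ≡ allFin n → All Consecutive t
  blocks-consecutive {t} concat≡ = Linked-concat⁻ t (subst Consecutive (sym concat≡) (allFin-consecutive n))

  ∈-some-block : ∀ {t} → concat t ≡ allFin n → ∀ i → ∃ λ b → i ∈ b × b ∈ t
  ∈-some-block {t} concat≡ i = ∈-concat⁻′ t (subst (i ∈_) (sym concat≡) (∈-allFin i))

  SameBlock-∈⇔ : ∀ {t b i j} → concat t ≡ allFin n → b ∈ t → SameBlock t i j → i ∈ b ⇔ j ∈ b
  SameBlock-∈⇔ concat≡ b∈t shared = mk⇔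
    (λ i∈b → ∈-sameBlock (<-irrefl refl) (blocks-separated concat≡) b∈t i∈b shared)
    (λ j∈b → ∈-sameBlock (<-irrefl refl) (blocks-separated concat≡) b∈t j∈b (Any.map swap shared))

  -- Were i + 1 missing from c, c would end in i and c ∷ʳ (i + 1) would be a larger interval.
  maximal-interval-∋-succ : ∀ {σ c i j} → IsMaximalInterval σ c → i ∈ c → Succ i j → Precedes σ i j → j ∈ c
  maximal-interval-∋-succ {σ} {c} {i} {j} ((_ , consecutive , precedes) , maximal) i∈c i⋖j i≺j with j ∈? c
  ... | yes j∈c = j∈c
  ... | no j∉c with c₀ , refl ← Linked-ends-at Succ-functional consecutive i∈c i⋖j j∉c =
    maximal (c ∷ʳ j) extended (λ _ → ∈-++⁺ˡ) j (∈-++⁺ʳ c (here refl))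
    where
    precedes-j : All (λ x → Precedes σ x j) c
    precedes-j = All.tabulate λ x∈c → case-∈ (∈-++⁻ c₀ x∈c)
      where
      case-∈ : ∀ {x} → x ∈ c₀ ⊎ x ∈ [ i ] → Precedes σ x j
      case-∈ (inj₁ x∈c₀)      = <-trans (proj₁ (AllPairs-++⁻ c₀ precedes) x∈c₀ (here refl)) i≺j
      case-∈ (inj₂ (here refl)) = i≺j
    extended : IsInterval σ (c ∷ʳ j)
    extended = (j , ∈-++⁺ʳ c (here refl)) , Linked-∷ʳ⁺ c₀ consecutive i⋖j ,
      AllPairsₚ.++⁺ precedes ([] ∷ []) (All.map (_∷ []) precedes-j)

  shs⇒joined : ∀ {σ t} → IsSHS σ t → JoinedBy (Precedes σ) t
  shs⇒joined {σ} {t} (maximal , _ , concat≡) =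
    concat≡ , All.map (proj₁ ∘ proj₁) maximal , λ i j i⋖j → mk⇔ (sameBlock⇒precedes i⋖j) (precedes⇒sameBlock i⋖j)
    where
    sameBlock⇒precedes : ∀ {i j} → Succ i j → SameBlock t i j → Precedes σ i j
    sameBlock⇒precedes i⋖j shared with _ , c∈t , i∈c , j∈c ← find shared
      with (_ , consecutive , precedes) , _ ← All.lookup maximal c∈t =
      AllPairs-transfer <-asym (Consecutive⇒sorted consecutive) precedes i∈c j∈c (Succ⇒< i⋖j)
    precedes⇒sameBlock : ∀ {i j} → Succ i j → Precedes σ i j → SameBlock t i j
    precedes⇒sameBlock {i} i⋖j i≺j with c , i∈c , c∈t ← ∈-some-block {t} concat≡ i =
      lose c∈t (i∈c , maximal-interval-∋-succ {σ} (All.lookup maximal c∈t) i∈c i⋖j i≺j)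

  module _ {σ : Permutation′ n} {t : List (List (Fin n))} (joined : JoinedBy (Precedes σ) t) where
    private
      concat≡ : concat t ≡ allFin n
      concat≡ = proj₁ joined
      nonEmpty : All NonEmpty t
      nonEmpty = proj₁ (proj₂ joined)
      joins : ∀ i j → Succ i j → SameBlock t i j ⇔ Precedes σ i j
      joins = proj₂ (proj₂ joined)

    block-interval : ∀ {b} → b ∈ t → IsInterval σ b
    block-interval b∈t = All.lookup nonEmpty b∈t , consecutive ,
      Linked⇒AllPairs <-trans (Linked-mapWith∈ (λ x∈b y∈b x⋖y → to (joins _ _ x⋖y) (lose b∈t (x∈b , y∈b))) consecutive)
      where consecutive = All.lookup (blocks-consecutive concat≡) b∈t

    interval-⊆-block : ∀ {b c z} → b ∈ t → IsInterval σ c → z ∈ b → z ∈ c → c ⊆ b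
    interval-⊆-block b∈t (_ , consecutive , precedes) z∈b z∈c =
      All.lookup (Linked-propagate (SameBlock-∈⇔ concat≡ b∈t) sameBlockLinks z∈c z∈b)
      where
      sameBlockLinks : Linked (SameBlock t) _
      sameBlockLinks = Linked.zipWith (λ (x⋖y , x≺y) → from (joins _ _ x⋖y) x≺y) (consecutive , AllPairs⇒Linked precedes)

    joined⇒shs : IsSHS σ t
    joined⇒shs = All.tabulate block-maximal , maximal-interval-∈-blocks , concat≡
      where
      block-maximal : ∀ {b} → b ∈ t → IsMaximalInterval σ b
      block-maximal b∈t with z , z∈b ← All.lookup nonEmpty b∈t =
        block-interval b∈t , λ c c-interval b⊆c x → interval-⊆-block b∈t c-interval z∈b (b⊆c z z∈b)
      maximal-interval-∈-blocks : ∀ b → IsMaximalInterval σ b → b ∈ t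
      maximal-interval-∈-blocks b (b-interval@((z , z∈b) , b-consecutive , _) , maximal)
        with c , z∈c , c∈t ← ∈-some-block {t} concat≡ z = subst (_∈ t) (sym b≡c) c∈t
        where
        b⊆c : b ⊆ c
        b⊆c = interval-⊆-block c∈t b-interval z∈c z∈b
        b≡c : b ≡ c
        b≡c = AllPairs-unique <-asym (Consecutive⇒sorted b-consecutive)
          (Consecutive⇒sorted (proj₁ (proj₂ (block-interval c∈t)))) b⊆c (maximal c (block-interval c∈t) (λ _ → b⊆c) _)

  shs⇔joined : ∀ {σ t} → IsSHS σ t ⇔ JoinedBy (Precedes σ) t
  shs⇔joined {σ} {t} = mk⇔ (shs⇒joined {σ} {t}) (joined⇒shs {σ} {t})

  BlockBelow : List (Fin n) → List (Fin n) → Set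
  BlockBelow b c = NonEmpty b × Across _<ᶠ_ b c

  BlockBelow-asym : Asymmetric BlockBelow
  BlockBelow-asym ((x , x∈b) , b<c) ((y , y∈c) , c<b) = <-asym (b<c x∈b y∈c) (c<b y∈c x∈b)

  shs-unique : ∀ {σ t t′} → IsSHS σ t → IsSHS σ t′ → t ≡ t′
  shs-unique {σ} shs shs′ = AllPairs-unique BlockBelow-asym (blocks-ordered shs) (blocks-ordered shs′)
    (blocks-⊆ shs shs′) (blocks-⊆ shs′ shs)
    where
    blocks-ordered : ∀ {t} → IsSHS σ t → AllPairs BlockBelow t
    blocks-ordered (maximal , _ , concat≡) =
      AllPairs-withAll (All.map (proj₁ ∘ proj₁) maximal) (blocks-separated concat≡)
    blocks-⊆ : ∀ {t t′} → IsSHS σ t → IsSHS σ t′ → t ⊆ t′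
    blocks-⊆ (maximal , _ , _) (_ , complete , _) b∈t = complete _ (All.lookup maximal b∈t)

  concat-evacS : ∀ (s : List (List (Fin n))) → concat (evacS s) ≡ reverse (map opposite (concat s))
  concat-evacS s = begin
    concat (reverse (map (reverse ∘ map opposite) s))       ≡⟨ cong (concat ∘ reverse) (map-∘ s) ⟩
    concat (reverse (map reverse (map (map opposite) s)))   ≡⟨ concat-reverse-map-reverse (map (map opposite) s) ⟩
    reverse (concat (map (map opposite) s))                 ≡⟨ cong reverse (concat-map s) ⟩
    reverse (map opposite (concat s))                       ∎
    where open ≡-Reasoning

  reverse-map-opposite-allFin : reverse (map opposite (allFin n)) ≡ allFin n
  reverse-map-opposite-allFin = AllPairs-unique <-asym
    (AllPairs-reverse⁺ (AllPairsₚ.map⁺ (AllPairs.map opposite-< allFin-sorted))) allFin-sorted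
    (λ _ → ∈-allFin _) (λ _ → from (∈-reverse-map⇔ opposite-involutive) (∈-allFin _))

  SameBlock-evacS : ∀ (s : List (List (Fin n))) {i j} → SameBlock (evacS s) i j ⇔ SameBlock s (opposite j) (opposite i)
  SameBlock-evacS s = mk⇔
    (Any.map (λ (i∈ , j∈) → to ∈-evac j∈ , to ∈-evac i∈) ∘ Anyₚ.map⁻ ∘ Anyₚ.reverse⁻)
    (Anyₚ.reverse⁺ ∘ Anyₚ.map⁺ ∘ Any.map (λ (j∈ , i∈) → from ∈-evac i∈ , from ∈-evac j∈))
    where
    ∈-evac : ∀ {x b} → x ∈ reverse (map opposite b) ⇔ opposite x ∈ b
    ∈-evac = ∈-reverse-map⇔ opposite-involutive

  joined-evacS : ∀ {R} {s : List (List (Fin n))} → JoinedBy R s → JoinedBy (λ i j → R (opposite j) (opposite i)) (evacS s)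
  joined-evacS {s = s} (concat≡ , nonEmpty , joins) = concat≡′ , nonEmpty′ , λ i j i⋖j →
    joins (opposite j) (opposite i) (Succ-opposite i⋖j) ⇔-∘ SameBlock-evacS s
    where
    concat≡′ : concat (evacS s) ≡ allFin n
    concat≡′ = trans (concat-evacS s) (trans (cong (reverse ∘ map opposite) concat≡) reverse-map-opposite-allFin)
    nonEmpty′ : All NonEmpty (evacS s)
    nonEmpty′ = All-reverse⁺ (Allₚ.map⁺
      (All.map (λ (x , x∈b) → opposite x , Anyₚ.reverse⁺ (∈-map⁺ opposite x∈b)) nonEmpty))

lemma3p4 : (n : ℕ) (π : Permutation′ n) (s : List (List (Fin n))) → IsSHS π s →
    (∀ t → IsSHS (rp π) t ⇔ IsRev s t) × (∀ t → IsSHS (evacP π) t ⇔ (t ≡ evacS s))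
lemma3p4 n π s shs = reversal , evacuation
  where
  joined : JoinedBy (Precedes π) s
  joined = to (shs⇔joined {σ = π}) shs

  rp-joins : ∀ {i j} → Succ i j → Precedes (rp π) i j ⇔ (¬ SameBlock s i j)
  rp-joins i⋖j = ¬-⇔ (⇔-sym (proj₂ (proj₂ joined) _ _ i⋖j))
    ⇔-∘ Precedes-rp π (λ i≡j → <-irrefl (cong toℕ i≡j) (Succ⇒< i⋖j))

  reversal : ∀ t → IsSHS (rp π) t ⇔ IsRev s t
  reversal t = JoinedBy-cong rp-joins ⇔-∘ shs⇔joined {σ = rp π}

  evac-shs : IsSHS (evacP π) (evacS s)
  evac-shs = from (shs⇔joined {σ = evacP π}) (to (JoinedBy-cong (λ _ → ⇔-sym (Precedes-evacP π))) (joined-evacS joined))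

  evacuation : ∀ t → IsSHS (evacP π) t ⇔ (t ≡ evacS s)
  evacuation t = mk⇔ (λ shs′ → shs-unique {σ = evacP π} shs′ evac-shs)
                     (λ t≡ → subst (IsSHS (evacP π)) (sym t≡) evac-shs)
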